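{- Let $n\geqslant 5$ be odd and let $\lambda$ be an integer with $\frac{n + 3}{4} \leqslant \lambda \leqslant \frac{n - 1}{2}$. Then $\mathbf{i}=\left(\lambda + 1, \frac{n + 3 - 2\lambda}{2}, 2\times \left(\frac{n-1}{2} - \lambda\right), 1\times \frac{4\lambda - n - 3}{2}\right)$ is a partition of $n$ and $\Lambda(\mathbf{i})=\lambda$; in particular $\lambda$ is an eigenvalue of $T_n$.
   Context: Notation $k\times t$ inside a partition means the part $k$ repeated $t$ times. For an integer partition $\mathbf{i}=(n_1,\dots,n_k)$ of $n$ (nonincreasing positive integers summing to $n$), $\Lambda(\mathbf{i})=\sum_{j=1}^k \frac{n_j(n_j-2j+1)}{2}$; this is the eigenvalue of the Transposition graph $T_n=\mathrm{Cay}(\mathrm{Sym}_n,\{\text{all transpositions}\})$ associated with the irreducible character of $\mathrm{Sym}_n$ indexed by $\mathbf{i}$, so $\Lambda(\mathbf{i})$ is an eigenvalue of $T_n$. -}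

module Defs where

open import Data.Nat as ℕ using (ℕ; zero; suc; _≥_; _<_)
open import Data.Integer as ℤ using (ℤ; +_)
open import Data.Integer.DivMod using (_/ℕ_)
open import Data.List using (List; []; _∷_)
open import Data.Nat.ListAction using (sum)
open import Data.List.Relation.Unary.All using (All)
open import Data.List.Relation.Unary.Linked using (Linked)
open import Data.Product using (_×_)
open import Relation.Binary.PropositionalEquality using (_≡_)

IsPartition : ℕ → List ℕ → Set
IsPartition n ps = All (λ p → 0 < p) ps × Linked _≥_ ps × sum ps ≡ n

-- Λ(n_1,…,n_k) = Σ_j n_j (n_j - 2j + 1) / 2  (each summand is an integer:
-- n_j(n_j - 2j + 1) is always even, so the division by 2 is exact).
Λterm : ℕ → ℕ → ℤ
Λterm j a = ((+ a) ℤ.* ((+ a) ℤ.- (+ (2 ℕ.* j)) ℤ.+ (+ 1))) /ℕ 2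

ΛFrom : ℕ → List ℕ → ℤ
ΛFrom j [] = + 0
ΛFrom j (a ∷ ps) = Λterm j a ℤ.+ ΛFrom (suc j) ps

Λ : List ℕ → ℤ
Λ = ΛFrom 1

-- Count the parts 2 and 1 of 𝐢 by a = (n - 1)/2 - λ and b = (4λ - n - 3)/2, so that
-- λ = a + b + 2, n = 4a + 2b + 5 and 𝐢 = (a + b + 3, a + 2, 2 × a, 1 × b).  The part x in
-- position j contributes x(x - 2j + 1)/2, and a run of a parts c starting in position j
-- contributes ac(c + 2 - 2j - a)/2; so 2Λ(𝐢) is a polynomial in a and b, and it equals 2λ.

{-# OPTIONS --safe #-}
module Submission where

open import Defs
open import Data.Nat as ℕ using (ℕ; zero; suc; _+_; _*_; _∸_; _%_; _/_; _≤_; _≥_; _<_; z≤n; s≤s)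
open import Data.Nat.Properties
  using ( ≤-refl; ≤-reflexive; ≤-trans; m≤m+n; m≤n+m; +-monoˡ-≤; *-cancelʳ-≤; m≤n⇒∃[o]m+o≡n
        ; +-identityʳ; +-suc; *-comm; *-distribʳ-+; +-cancelˡ-≡; m+n∸n≡m; m+n∸m≡n )
open import Data.Nat.DivMod using (m*n/n≡m; m*n%n≡0; m≡m%n+[m/n]*n)
open import Data.Nat.Combinatorics using (_C_; nC1≡n; nCk+nC[k+1]≡[n+1]C[k+1])
open import Data.Nat.ListAction using (sum)
open import Data.Nat.ListAction.Properties using (sum-++)
open import Data.Nat.Tactic.RingSolver using (solve)
open import Data.Integer as ℤ using (ℤ; +_; -[1+_])
open import Data.Integer.DivMod using (_/ℕ_)
import Data.Integer.Properties as ℤₚ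
import Data.Integer.Tactic.RingSolver as ℤ-Solver
open import Data.List using (List; []; _∷_; _++_; replicate; length)
open import Data.List.Properties using (length-replicate)
import Data.List.Relation.Unary.All as All
open import Data.List.Relation.Unary.All.Properties using (++⁺; replicate⁺)
open import Data.List.Relation.Unary.Linked as Linked using (Linked; [-])
open import Data.Product using (∃; ∃₂; _×_; _,_)
open import Relation.Binary.PropositionalEquality
  using (_≡_; refl; sym; trans; cong; cong₂; subst; module ≡-Reasoning)
open ≡-Reasoning

[1+n]C2*2≡[1+n]*n : ∀ n → (suc n C 2) * 2 ≡ suc n * n
[1+n]C2*2≡[1+n]*n zero    = refl
[1+n]C2*2≡[1+n]*n (suc n) = begin
  (suc (suc n) C 2) * 2         ≡⟨ cong (_* 2) (nCk+nC[k+1]≡[n+1]C[k+1] (suc n) 1) ⟨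
  (suc n C 1 + suc n C 2) * 2   ≡⟨ cong (λ k → (k + suc n C 2) * 2) (nC1≡n (suc n)) ⟩
  (suc n + suc n C 2) * 2       ≡⟨ *-distribʳ-+ 2 (suc n) (suc n C 2) ⟩
  suc n * 2 + (suc n C 2) * 2   ≡⟨ cong (λ k → suc n * 2 + k) ([1+n]C2*2≡[1+n]*n n) ⟩
  suc n * 2 + suc n * n         ≡⟨ solve (n ∷ []) ⟩
  suc (suc n) * suc n           ∎

odd⇒≡suc[m*2] : ∀ n → n % 2 ≡ 1 → ∃ λ m → n ≡ suc (m * 2)
odd⇒≡suc[m*2] n n%2≡1 = n / 2 , trans (m≡m%n+[m/n]*n n 2) (cong (_+ n / 2 * 2) n%2≡1)

[x∸y]/2≡z : ∀ {x} y z → x ≡ z * 2 + y → (x ∸ y) / 2 ≡ z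
[x∸y]/2≡z y z refl = trans (cong (_/ 2) (m+n∸n≡m (z * 2) y)) (m*n/n≡m z 2)

-[1+n]/ℕd : ∀ n d .{{_ : ℕ.NonZero d}} → suc n % d ≡ 0 → -[1+ n ] /ℕ d ≡ ℤ.- + (suc n / d)
-[1+n]/ℕd n d _ with suc n % d
-[1+n]/ℕd n d refl | .0 = refl

i*n/ℕn≡i : ∀ i n .{{_ : ℕ.NonZero n}} → (i ℤ.* + n) /ℕ n ≡ i
i*n/ℕn≡i (+ m) n = begin
  (+ m ℤ.* + n) /ℕ n ≡⟨ cong (_/ℕ n) (ℤₚ.pos-* m n) ⟨
  + (m * n / n)      ≡⟨ cong +_ (m*n/n≡m m n) ⟩
  + m                ∎
i*n/ℕn≡i -[1+ m ] n@(suc n-1) = begin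
  -[1+ n-1 + m * n ] /ℕ n  ≡⟨ -[1+n]/ℕd (n-1 + m * n) n (m*n%n≡0 (suc m) n) ⟩
  ℤ.- + (suc m * n / n)     ≡⟨ cong (λ k → ℤ.- + k) (m*n/n≡m (suc m) n) ⟩
  -[1+ m ]                  ∎

sum-replicate : ∀ n x → sum (replicate n x) ≡ n * x
sum-replicate zero    x = refl
sum-replicate (suc n) x = cong (λ k → x + k) (sum-replicate n x)

Linked-≥-replicate-++ : ∀ {m x y} a b → m ≥ x → x ≥ y → Linked _≥_ (m ∷ replicate a x ++ replicate b y)
Linked-≥-replicate-++ (suc a) b m≥x x≥y =
  m≥x Linked.∷ Linked-≥-replicate-++ a b ≤-refl x≥y
Linked-≥-replicate-++ {y = y} zero (suc b) m≥x x≥y =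
  ≤-trans x≥y m≥x Linked.∷ Linked-≥-replicate-++ {x = y} zero b ≤-refl ≤-refl
Linked-≥-replicate-++ zero zero _ _ = [-]

Λterm*2 : ∀ j x → Λterm j x ℤ.* + 2 ≡ + x ℤ.* (+ x ℤ.- + 2 ℤ.* + j ℤ.+ + 1)
Λterm*2 j x = begin
  Λterm j x ℤ.* + 2
    ≡⟨ cong (λ k → (+ x ℤ.* (+ x ℤ.- k ℤ.+ + 1)) /ℕ 2 ℤ.* + 2) (ℤₚ.pos-* 2 j) ⟩
  (+ x ℤ.* (+ x ℤ.- + 2 ℤ.* + j ℤ.+ + 1)) /ℕ 2 ℤ.* + 2
    ≡⟨ cong (λ k → k /ℕ 2 ℤ.* + 2) numerator≡half*2 ⟩
  (half ℤ.* + 2) /ℕ 2 ℤ.* + 2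
    ≡⟨ cong (ℤ._* + 2) (i*n/ℕn≡i half 2) ⟩
  half ℤ.* + 2
    ≡⟨ numerator≡half*2 ⟨
  + x ℤ.* (+ x ℤ.- + 2 ℤ.* + j ℤ.+ + 1)
    ∎
  where
  -- x(x - 2j + 1) = 2(C(x + 1, 2) - jx), so the division in Λterm is exact.
  half : ℤ
  half = + (suc x C 2) ℤ.- + j ℤ.* + x

  expand : ∀ X J → X ℤ.* (X ℤ.- + 2 ℤ.* J ℤ.+ + 1) ≡ (+ 1 ℤ.+ X) ℤ.* X ℤ.- + 2 ℤ.* (J ℤ.* X)
  expand = ℤ-Solver.solve-∀

  collect : ∀ T J X → T ℤ.* + 2 ℤ.- + 2 ℤ.* (J ℤ.* X) ≡ (T ℤ.- J ℤ.* X) ℤ.* + 2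
  collect = ℤ-Solver.solve-∀

  numerator≡half*2 : + x ℤ.* (+ x ℤ.- + 2 ℤ.* + j ℤ.+ + 1) ≡ half ℤ.* + 2
  numerator≡half*2 = begin
    + x ℤ.* (+ x ℤ.- + 2 ℤ.* + j ℤ.+ + 1)
      ≡⟨ expand (+ x) (+ j) ⟩
    + suc x ℤ.* + x ℤ.- + 2 ℤ.* (+ j ℤ.* + x)
      ≡⟨ cong (ℤ._- + 2 ℤ.* (+ j ℤ.* + x)) (ℤₚ.pos-* (suc x) x) ⟨
    + (suc x * x) ℤ.- + 2 ℤ.* (+ j ℤ.* + x)
      ≡⟨ cong (λ k → + k ℤ.- + 2 ℤ.* (+ j ℤ.* + x)) ([1+n]C2*2≡[1+n]*n x) ⟨
    + ((suc x C 2) * 2) ℤ.- + 2 ℤ.* (+ j ℤ.* + x)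
      ≡⟨ cong (ℤ._- + 2 ℤ.* (+ j ℤ.* + x)) (ℤₚ.pos-* (suc x C 2) 2) ⟩
    + (suc x C 2) ℤ.* + 2 ℤ.- + 2 ℤ.* (+ j ℤ.* + x)
      ≡⟨ collect (+ (suc x C 2)) (+ j) (+ x) ⟩
    half ℤ.* + 2
      ∎

ΛFrom-∷*2 : ∀ j x xs →
  ΛFrom j (x ∷ xs) ℤ.* + 2 ≡ + x ℤ.* (+ x ℤ.- + 2 ℤ.* + j ℤ.+ + 1) ℤ.+ ΛFrom (suc j) xs ℤ.* + 2
ΛFrom-∷*2 j x xs = begin
  (Λterm j x ℤ.+ ΛFrom (suc j) xs) ℤ.* + 2
    ≡⟨ ℤₚ.*-distribʳ-+ (+ 2) (Λterm j x) (ΛFrom (suc j) xs) ⟩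
  Λterm j x ℤ.* + 2 ℤ.+ ΛFrom (suc j) xs ℤ.* + 2
    ≡⟨ cong (ℤ._+ ΛFrom (suc j) xs ℤ.* + 2) (Λterm*2 j x) ⟩
  + x ℤ.* (+ x ℤ.- + 2 ℤ.* + j ℤ.+ + 1) ℤ.+ ΛFrom (suc j) xs ℤ.* + 2
    ∎

ΛFrom-++ : ∀ j xs ys → ΛFrom j (xs ++ ys) ≡ ΛFrom j xs ℤ.+ ΛFrom (j + length xs) ys
ΛFrom-++ j []       ys = begin
  ΛFrom j ys                ≡⟨ cong (λ k → ΛFrom k ys) (+-identityʳ j) ⟨
  ΛFrom (j + 0) ys          ≡⟨ ℤₚ.+-identityˡ _ ⟨
  + 0 ℤ.+ ΛFrom (j + 0) ys  ∎
ΛFrom-++ j (x ∷ xs) ys = begin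
  Λterm j x ℤ.+ ΛFrom (suc j) (xs ++ ys)
    ≡⟨ cong (λ k → Λterm j x ℤ.+ k) (ΛFrom-++ (suc j) xs ys) ⟩
  Λterm j x ℤ.+ (ΛFrom (suc j) xs ℤ.+ ΛFrom (suc j + length xs) ys)
    ≡⟨ ℤₚ.+-assoc (Λterm j x) _ _ ⟨
  Λterm j x ℤ.+ ΛFrom (suc j) xs ℤ.+ ΛFrom (suc j + length xs) ys
    ≡⟨ cong (λ k → Λterm j x ℤ.+ ΛFrom (suc j) xs ℤ.+ ΛFrom k ys) (+-suc j (length xs)) ⟨
  Λterm j x ℤ.+ ΛFrom (suc j) xs ℤ.+ ΛFrom (j + suc (length xs)) ys
    ∎

ΛFrom-replicate*2 : ∀ j a c →
  ΛFrom j (replicate a c) ℤ.* + 2 ≡ + a ℤ.* + c ℤ.* (+ c ℤ.+ + 2 ℤ.- + 2 ℤ.* + j ℤ.- + a)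
ΛFrom-replicate*2 j zero    c = refl
ΛFrom-replicate*2 j (suc a) c = begin
  ΛFrom j (c ∷ replicate a c) ℤ.* + 2
    ≡⟨ ΛFrom-∷*2 j c (replicate a c) ⟩
  + c ℤ.* (+ c ℤ.- + 2 ℤ.* + j ℤ.+ + 1) ℤ.+ ΛFrom (suc j) (replicate a c) ℤ.* + 2
    ≡⟨ cong (λ k → + c ℤ.* (+ c ℤ.- + 2 ℤ.* + j ℤ.+ + 1) ℤ.+ k) (ΛFrom-replicate*2 (suc j) a c) ⟩
  + c ℤ.* (+ c ℤ.- + 2 ℤ.* + j ℤ.+ + 1) ℤ.+ + a ℤ.* + c ℤ.* (+ c ℤ.+ + 2 ℤ.- + 2 ℤ.* (+ 1 ℤ.+ + j) ℤ.- + a)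
    ≡⟨ step (+ j) (+ a) (+ c) ⟩
  (+ 1 ℤ.+ + a) ℤ.* + c ℤ.* (+ c ℤ.+ + 2 ℤ.- + 2 ℤ.* + j ℤ.- (+ 1 ℤ.+ + a))
    ∎
  where
  step : ∀ J A C →
    C ℤ.* (C ℤ.- + 2 ℤ.* J ℤ.+ + 1) ℤ.+ A ℤ.* C ℤ.* (C ℤ.+ + 2 ℤ.- + 2 ℤ.* (+ 1 ℤ.+ J) ℤ.- A)
      ≡ (+ 1 ℤ.+ A) ℤ.* C ℤ.* (C ℤ.+ + 2 ℤ.- + 2 ℤ.* J ℤ.- (+ 1 ℤ.+ A))
  step = ℤ-Solver.solve-∀

eigenPartition : ℕ → ℕ → List ℕ
eigenPartition a b = (a + b + 2 + 1) ∷ (a + 2) ∷ (replicate a 2 ++ replicate b 1)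

Λ-eigenPartition : ∀ a b → Λ (eigenPartition a b) ≡ + (a + b + 2)
Λ-eigenPartition a b = ℤₚ.*-cancelʳ-≡ _ _ (+ 2) (begin
  Λ (eigenPartition a b) ℤ.* + 2
    ≡⟨ ΛFrom-∷*2 1 (a + b + 2 + 1) ((a + 2) ∷ twos ++ ones) ⟩
  P ℤ.+ ΛFrom 2 ((a + 2) ∷ twos ++ ones) ℤ.* + 2
    ≡⟨ cong (λ k → P ℤ.+ k) (ΛFrom-∷*2 2 (a + 2) (twos ++ ones)) ⟩
  P ℤ.+ (Q ℤ.+ ΛFrom 3 (twos ++ ones) ℤ.* + 2)
    ≡⟨ cong (λ k → P ℤ.+ (Q ℤ.+ k ℤ.* + 2)) (ΛFrom-++ 3 twos ones) ⟩
  P ℤ.+ (Q ℤ.+ (ΛFrom 3 twos ℤ.+ ΛFrom (3 + length twos) ones) ℤ.* + 2)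
    ≡⟨ cong (λ k → P ℤ.+ (Q ℤ.+ (ΛFrom 3 twos ℤ.+ ΛFrom (3 + k) ones) ℤ.* + 2)) (length-replicate a) ⟩
  P ℤ.+ (Q ℤ.+ (ΛFrom 3 twos ℤ.+ ΛFrom (3 + a) ones) ℤ.* + 2)
    ≡⟨ cong (λ k → P ℤ.+ (Q ℤ.+ k)) (ℤₚ.*-distribʳ-+ (+ 2) (ΛFrom 3 twos) _) ⟩
  P ℤ.+ (Q ℤ.+ (ΛFrom 3 twos ℤ.* + 2 ℤ.+ ΛFrom (3 + a) ones ℤ.* + 2))
    ≡⟨ cong₂ (λ u v → P ℤ.+ (Q ℤ.+ (u ℤ.+ v))) (ΛFrom-replicate*2 3 a 2) (ΛFrom-replicate*2 (3 + a) b 1) ⟩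
  P ℤ.+ (Q ℤ.+ (A ℤ.* + 2 ℤ.* (+ 2 ℤ.+ + 2 ℤ.- + 2 ℤ.* + 3 ℤ.- A)
              ℤ.+ B ℤ.* + 1 ℤ.* (+ 1 ℤ.+ + 2 ℤ.- + 2 ℤ.* (+ 3 ℤ.+ A) ℤ.- B)))
    ≡⟨ closed-form A B ⟩
  (A ℤ.+ B ℤ.+ + 2) ℤ.* + 2
    ∎)
  where
  twos ones : List ℕ
  twos = replicate a 2
  ones = replicate b 1

  A B P Q : ℤ
  A = + a
  B = + b
  P = (A ℤ.+ B ℤ.+ + 2 ℤ.+ + 1) ℤ.* (A ℤ.+ B ℤ.+ + 2 ℤ.+ + 1 ℤ.- + 2 ℤ.* + 1 ℤ.+ + 1)
  Q = (A ℤ.+ + 2) ℤ.* (A ℤ.+ + 2 ℤ.- + 2 ℤ.* + 2 ℤ.+ + 1)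

  closed-form : ∀ A B →
    (A ℤ.+ B ℤ.+ + 2 ℤ.+ + 1) ℤ.* (A ℤ.+ B ℤ.+ + 2 ℤ.+ + 1 ℤ.- + 2 ℤ.* + 1 ℤ.+ + 1)
      ℤ.+ ((A ℤ.+ + 2) ℤ.* (A ℤ.+ + 2 ℤ.- + 2 ℤ.* + 2 ℤ.+ + 1)
      ℤ.+ (A ℤ.* + 2 ℤ.* (+ 2 ℤ.+ + 2 ℤ.- + 2 ℤ.* + 3 ℤ.- A)
      ℤ.+ B ℤ.* + 1 ℤ.* (+ 1 ℤ.+ + 2 ℤ.- + 2 ℤ.* (+ 3 ℤ.+ A) ℤ.- B)))
      ≡ (A ℤ.+ B ℤ.+ + 2) ℤ.* + 2
  closed-form = ℤ-Solver.solve-∀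

eigenPartition-isPartition : ∀ a b → IsPartition (suc ((a + b + 2 + a) * 2)) (eigenPartition a b)
eigenPartition-isPartition a b = positive , nonincreasing , total
  where
  1≤2 : 1 ≤ 2
  1≤2 = s≤s z≤n

  positive : All.All (0 <_) (eigenPartition a b)
  positive = m≤n+m 1 (a + b + 2) All.∷ ≤-trans 1≤2 (m≤n+m 2 a)
             All.∷ ++⁺ (replicate⁺ a 1≤2) (replicate⁺ b ≤-refl)

  nonincreasing : Linked _≥_ (eigenPartition a b)
  nonincreasing = ≤-trans (+-monoˡ-≤ 2 (m≤m+n a b)) (m≤m+n (a + b + 2) 1)
                  Linked.∷ Linked-≥-replicate-++ a b (m≤n+m 2 a) 1≤2

  total : sum (eigenPartition a b) ≡ suc ((a + b + 2 + a) * 2)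
  total = begin
    a + b + 2 + 1 + (a + 2 + sum (replicate a 2 ++ replicate b 1))
      ≡⟨ cong (λ k → a + b + 2 + 1 + (a + 2 + k)) (sum-++ (replicate a 2) (replicate b 1)) ⟩
    a + b + 2 + 1 + (a + 2 + (sum (replicate a 2) + sum (replicate b 1)))
      ≡⟨ cong₂ (λ u v → a + b + 2 + 1 + (a + 2 + (u + v))) (sum-replicate a 2) (sum-replicate b 1) ⟩
    a + b + 2 + 1 + (a + 2 + (a * 2 + b * 1))
      ≡⟨ solve (a ∷ b ∷ []) ⟩
    suc ((a + b + 2 + a) * 2)
      ∎

blockSizes : ∀ m l → suc (m * 2) + 3 ≤ 4 * l → 2 * l ≤ m * 2 →
  ∃₂ λ a b → m ≡ a + b + 2 + a × l ≡ a + b + 2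
blockSizes m l lower upper with m≤n⇒∃[o]m+o≡n l≤m | m≤n⇒∃[o]m+o≡n m+2≤2*l
  where
  l≤m : l ≤ m
  l≤m = *-cancelʳ-≤ l m 2 (subst (_≤ m * 2) (*-comm 2 l) upper)

  [m+2]*2≡ : (m + 2) * 2 ≡ suc (m * 2) + 3
  [m+2]*2≡ = solve (m ∷ [])

  4*l≡ : 4 * l ≡ 2 * l * 2
  4*l≡ = solve (l ∷ [])

  m+2≤2*l : m + 2 ≤ 2 * l
  m+2≤2*l = *-cancelʳ-≤ (m + 2) (2 * l) 2
    (≤-trans (≤-reflexive [m+2]*2≡) (≤-trans lower (≤-reflexive 4*l≡)))
... | a , refl | b , l+a+2+b≡2*l = a , b , cong (_+ a) l≡a+b+2 , l≡a+b+2
  where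
  l≡a+b+2 : l ≡ a + b + 2
  l≡a+b+2 = +-cancelˡ-≡ l l (a + b + 2) (begin
    l + l              ≡⟨ solve (l ∷ []) ⟩
    2 * l              ≡⟨ l+a+2+b≡2*l ⟨
    l + a + 2 + b      ≡⟨ solve (l ∷ a ∷ b ∷ []) ⟩
    l + (a + b + 2)    ∎)

𝐢 : ℕ → ℕ → List ℕ
𝐢 n l = (l + 1) ∷ ((n + 3 ∸ 2 * l) / 2) ∷ (replicate ((n ∸ 1) / 2 ∸ l) 2 ++ replicate ((4 * l ∸ (n + 3)) / 2) 1)

𝐢≡eigenPartition : ∀ a b → 𝐢 (suc ((a + b + 2 + a) * 2)) (a + b + 2) ≡ eigenPartition a b
𝐢≡eigenPartition a b =
  cong₂ (λ q rest → (a + b + 2 + 1) ∷ q ∷ rest)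
        ([x∸y]/2≡z (2 * (a + b + 2)) (a + 2) n+3≡)
        (cong₂ (λ r s → replicate r 2 ++ replicate s 1) twos ([x∸y]/2≡z (n + 3) b 4*l≡))
  where
  n : ℕ
  n = suc ((a + b + 2 + a) * 2)

  n+3≡ : suc ((a + b + 2 + a) * 2) + 3 ≡ (a + 2) * 2 + 2 * (a + b + 2)
  n+3≡ = solve (a ∷ b ∷ [])

  4*l≡ : 4 * (a + b + 2) ≡ b * 2 + (suc ((a + b + 2 + a) * 2) + 3)
  4*l≡ = solve (a ∷ b ∷ [])

  twos : (n ∸ 1) / 2 ∸ (a + b + 2) ≡ a
  twos = trans (cong (_∸ (a + b + 2)) (m*n/n≡m (a + b + 2 + a) 2)) (m+n∸m≡n (a + b + 2) a)

lemma5 : (n λ' : ℕ) → 5 ≤ n → n % 2 ≡ 1 → n + 3 ≤ 4 * λ' → 2 * λ' ≤ n ∸ 1 →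
    let i = (λ' + 1) ∷ ((n + 3 ∸ 2 * λ') / 2) ∷ (replicate ((n ∸ 1) / 2 ∸ λ') 2 ++ replicate ((4 * λ' ∸ (n + 3)) / 2) 1)
    in IsPartition n i × Λ i ≡ + λ'
-- The hypothesis 5 ≤ n is implied by the two bounds on λ'.
lemma5 n λ' _ n-odd lower upper with odd⇒≡suc[m*2] n n-odd
... | m , refl with blockSizes m λ' lower upper
... | a , b , refl , refl =
  subst (λ i → IsPartition n i × Λ i ≡ + λ') (sym (𝐢≡eigenPartition a b))
        (eigenPartition-isPartition a b , Λ-eigenPartition a b)
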